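{- Let $S=\{x_1,\ldots,x_n\}$ be a gcd-closed set of distinct positive integers, let $1\le i,j\le n$, and let $G_S(x_j)=\{y_{j,1},\ldots,y_{j,m}\}$ be the set of greatest-type divisors of $x_j$ in $S$. Then $$c_{ij}=\sum_{d\mid \frac{x_j}{x_i}}\mu(d)+\sum_{r=1}^{m}(-1)^r\sum_{1\le i_1<\cdots<i_r\le m}\ \sum_{d\mid \frac{(y_{j,i_1},\ldots,y_{j,i_r})}{x_i}}\mu(d)$$ and $$\alpha_j=\sum_{x_i\mid x_j} x_i\,c_{ij}.$$
   Context: $\mu$ is the Möbius function and $\varphi$ is Euler's totient function. A set $S$ of positive integers is gcd-closed if $\gcd(x,y)\in S$ for all $x,y\in S$. For $x,y\in S$ with $x<y$, $x$ is a greatest-type divisor of $y$ in $S$ if $x\mid y$ and the conditions $x\mid z\mid y$, $z\in S$ imply $z\in\{x,y\}$; $G_S(y)$ denotes the set of greatest-type divisors of $y$ in $S$. For $1\le i,j\le n$, $c_{ij}=\sum \mu(d)$, where the sum runs over positive integers $d$ such that $dx_i\mid x_j$ and $dx_i\nmid x_t$ for every $x_t\in S$ with $x_t<x_j$. Also $\alpha_j=\sum\varphi(d)$, the sum over positive integers $d$ with $d\mid x_j$ and $d\nmid x_t$ for every $x_t\in S$ with $x_t<x_j$. Convention: for a positive rational $r$, $\sum_{d\mid r}\mu(d)$ is the sum over positive divisors $d$ of $r$ if $r$ is an integer, and is $0$ (empty sum) if $r$ is not an integer. $(a_1,\ldots,a_k)$ denotes the gcd. -}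

module Defs where

open import Data.Nat using (ℕ; zero; suc; _*_; _<_)
open import Data.Nat.Divisibility using (_∣_; _∣?_; quotient)
open import Data.Nat.GCD using (gcd)
open import Data.Nat.Primality using (prime?)
open import Data.Integer as ℤ using (ℤ; +_; -_)
open import Data.Fin using (Fin)
open import Data.List using (List; []; _∷_; map; filter; foldr; length; upTo; allFin; _++_)
open import Data.Bool using (Bool; true; false; if_then_else_)
open import Data.Product using (Σ; _×_; ∃)
open import Data.Sum using (_⊎_)
open import Relation.Nullary using (yes; no; does; ¬_)
open import Relation.Binary.PropositionalEquality using (_≡_)

sumℤ : List ℤ → ℤ
sumℤ = foldr ℤ._+_ (+ 0)

sumℕ : List ℕ → ℕ
sumℕ = foldr Data.Nat._+_ 0
  where import Data.Nat

allB : {A : Set} → (A → Bool) → List A → Bool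
allB p = foldr (λ a b → p a Data.Bool.∧ b) true
  where import Data.Bool

oneTo : ℕ → List ℕ
oneTo N = map suc (upTo N)

neg1^ : ℕ → ℤ
neg1^ zero = + 1
neg1^ (suc k) = - neg1^ k

-- Möbius function (for n ≥ 1): 0 if k² ∣ n for some k ≥ 2,
-- otherwise (-1)^(number of distinct primes dividing n).
-- (The value at 0 is irrelevant; it is never used.)
hasSquareFactor : ℕ → Bool
hasSquareFactor n =
  foldr (λ k b → does (suc (suc k) * suc (suc k) ∣? n) Data.Bool.∨ b) false (upTo n)
  where import Data.Bool

numPrimeDivisors : ℕ → ℕ
numPrimeDivisors n = length (filter (λ p → prime? p Relation.Nullary.×-dec (p ∣? n)) (oneTo n))
  where import Relation.Nullary

μ : ℕ → ℤ
μ n = if hasSquareFactor n then + 0 else neg1^ (numPrimeDivisors n)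

φ : ℕ → ℕ
φ n = length (filter (λ k → gcd k n Data.Nat.≟ 1) (oneTo n))
  where import Data.Nat

sumDivμ : ℕ → ℤ
sumDivμ q = sumℤ (map μ (filter (λ d → d ∣? q) (oneTo q)))

-- Convention of the paper: Σ_{d ∣ a/b} μ(d) is the divisor sum of the
-- integer a/b when b ∣ a, and 0 (empty sum) otherwise.
sumDivμFrac : ℕ → ℕ → ℤ
sumDivμFrac a b with b ∣? a
... | yes b∣a = sumDivμ (quotient b∣a)
... | no _ = + 0

gcdList : List ℕ → ℕ
gcdList = foldr gcd 0

-- all sublists (subsequences) of a list: they correspond exactly to the
-- index tuples 1 ≤ i₁ < ⋯ < i_r ≤ m
sublists : {A : Set} → List A → List (List A)
sublists [] = [] ∷ []
sublists (y ∷ ys) = map (y ∷_) (sublists ys) ++ sublists ys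

_∈S_ : ℕ → {n : ℕ} → (Fin n → ℕ) → Set
z ∈S x = ∃ λ k → x k ≡ z

GcdClosed : {n : ℕ} → (Fin n → ℕ) → Set
GcdClosed {n} x = (a b : Fin n) → gcd (x a) (x b) ∈S x

IsGreatestTypeDivisor : {n : ℕ} → (Fin n → ℕ) → ℕ → ℕ → Set
IsGreatestTypeDivisor {n} x z y =
  z ∈S x × y ∈S x × z < y × z ∣ y ×
  ((t : Fin n) → z ∣ x t → x t ∣ y → (x t ≡ z) ⊎ (x t ≡ y))

-- c_{ij} = Σ μ(d) over d ≥ 1 with d x_i ∣ x_j and d x_i ∤ x_t for all x_t < x_j.
-- (Such d satisfy d ≤ x_j since x_j ≥ 1, so d ranges over [1, x_j].)
cond-c : {n : ℕ} → (Fin n → ℕ) → Fin n → Fin n → ℕ → Bool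
cond-c {n} x i j d =
  does (d * x i ∣? x j) Data.Bool.∧
  allB (λ t → if does (x t Data.Nat.<? x j)
                        then Data.Bool.not (does (d * x i ∣? x t)) else true)
                (allFin n)
  where import Data.Bool ; import Data.List ; import Data.Nat

c : {n : ℕ} → (Fin n → ℕ) → Fin n → Fin n → ℤ
c x i j = sumℤ (map μ (Data.List.filterᵇ (cond-c x i j) (oneTo (x j))))
  where import Data.List

cond-α : {n : ℕ} → (Fin n → ℕ) → Fin n → ℕ → Bool
cond-α {n} x j d =
  does (d ∣? x j) Data.Bool.∧
  allB (λ t → if does (x t Data.Nat.<? x j)
                        then Data.Bool.not (does (d ∣? x t)) else true)
                (allFin n)
  where import Data.Bool ; import Data.List ; import Data.Nat

α : {n : ℕ} → (Fin n → ℕ) → Fin n → ℕ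
α x j = sumℕ (map φ (Data.List.filterᵇ (cond-α x j) (oneTo (x j))))
  where import Data.List

isNonEmpty : {A : Set} → List A → Bool
isNonEmpty [] = false
isNonEmpty (_ ∷ _) = true

-- Let A be the set of m with m ∣ X and m ∤ x_t for all x_t < X.  Then
-- c_ij = Σ_{e·x_i ∈ A} μ(e) and α_j = Σ_{m ∈ A} φ(m).  Since S is gcd-closed,
-- every x_t < X gives a proper divisor gcd(x_t, X) ∈ S of X, which lies
-- below a greatest-type divisor; hence m ∈ A iff m ∣ X and m divides no
-- element of G_S(X).  Inclusion–exclusion over the sublists T of G_S(X)
-- gives [m ∈ A] = Σ_T (-1)^|T| [m ∣ gcd(X, T)], and summing μ(e) over
-- m = e·x_i yields the first formula.  For the second, φ(m) = Σ_{e·d = m} μ(e) d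
-- turns α_j into Σ_d d·Σ_{e·d ∈ A} μ(e); by the same expansion and the Möbius
-- identity the inner sum vanishes unless d = gcd(X, T) ∈ S.
module Submission where

open import Defs
open import Data.Nat using (ℕ; _<_)
open import Data.Nat.Divisibility using (_∣?_)
open import Data.Integer using (+_; _+_; _*_)
open import Data.Fin using (Fin)
open import Data.List using (List; []; _∷_; map; filter; filterᵇ; length; allFin)
open import Data.List.Relation.Unary.Unique.Propositional using (Unique)
open import Data.List.Membership.Propositional using (_∈_)
open import Data.Product using (_×_; _,_)
open import Function using (Injective; _⇔_)
open import Relation.Binary.PropositionalEquality using (_≡_)

module FiniteSums where

  open import Data.Nat as ℕ using (zero; suc; z≤n; s≤s)
  import Data.Nat.Properties as ℕP
  open import Data.Integer as ℤ using (ℤ; -_)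
  import Data.Integer.Properties as ℤP
  open import Data.Integer.Tactic.RingSolver using (solve-∀)
  open import Data.Bool using (Bool; true; false; _∧_)
  open import Data.List using (_++_; upTo; [_])
  import Data.List.Properties as LP
  open import Data.List.Relation.Unary.Any using (here; there)
  open import Relation.Unary using (Decidable)
  open import Relation.Binary.PropositionalEquality hiding ([_])
  open import Relation.Nullary using (yes; no; does; Dec)
  open import Relation.Nullary.Decidable using (dec-true; dec-false; T?)
  open import Data.List.Relation.Unary.All as All using (All; []; _∷_)
  open import Data.List.Relation.Unary.AllPairs using (_∷_)

  𝟙 : Bool → ℤ
  𝟙 true = + 1
  𝟙 false = + 0

  𝟙-∧ : ∀ a b → 𝟙 (a ∧ b) ≡ 𝟙 a * 𝟙 b
  𝟙-∧ true true = refl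
  𝟙-∧ true false = refl
  𝟙-∧ false b = sym (ℤP.*-zeroˡ (𝟙 b))

  Bool-ext : ∀ {a b : Bool} → (a ≡ true → b ≡ true) → (b ≡ true → a ≡ true) → a ≡ b
  Bool-ext {false} {false} f g = refl
  Bool-ext {false} {true} f g = g refl
  Bool-ext {true} {false} f g = sym (f refl)
  Bool-ext {true} {true} f g = refl

  does⇒ : ∀ {A : Set} (a? : Dec A) → does a? ≡ true → A
  does⇒ (yes a) _ = a
  does⇒ (no _) ()

  ∑ : ℕ → (ℕ → ℤ) → ℤ
  ∑ zero f = + 0
  ∑ (suc N) f = ∑ N f + f (suc N)

  ∑-cong : ∀ N {f g : ℕ → ℤ} → (∀ d → 1 ℕ.≤ d → d ℕ.≤ N → f d ≡ g d) → ∑ N f ≡ ∑ N g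
  ∑-cong zero h = refl
  ∑-cong (suc N) h =
    cong₂ _+_ (∑-cong N (λ d p q → h d p (ℕP.m≤n⇒m≤1+n q))) (h (suc N) (s≤s z≤n) ℕP.≤-refl)

  ∑-zero : ∀ N {f : ℕ → ℤ} → (∀ d → 1 ℕ.≤ d → d ℕ.≤ N → f d ≡ + 0) → ∑ N f ≡ + 0
  ∑-zero zero h = refl
  ∑-zero (suc N) h
    rewrite ∑-zero N (λ d p q → h d p (ℕP.m≤n⇒m≤1+n q)) | h (suc N) (s≤s z≤n) ℕP.≤-refl = refl

  ∑-+ : ∀ N (f g : ℕ → ℤ) → ∑ N (λ d → f d + g d) ≡ ∑ N f + ∑ N g
  ∑-+ zero f g = refl
  ∑-+ (suc N) f g rewrite ∑-+ N f g = interchange (∑ N f) (∑ N g) (f (suc N)) (g (suc N))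
    where
    interchange : ∀ a b c d → a + b + (c + d) ≡ a + c + (b + d)
    interchange = solve-∀

  ∑-*ˡ : ∀ N (c : ℤ) (f : ℕ → ℤ) → c * ∑ N f ≡ ∑ N (λ d → c * f d)
  ∑-*ˡ zero c f = ℤP.*-zeroʳ c
  ∑-*ˡ (suc N) c f rewrite sym (∑-*ˡ N c f) = ℤP.*-distribˡ-+ c (∑ N f) (f (suc N))

  ∑-neg : ∀ N (f : ℕ → ℤ) → - ∑ N f ≡ ∑ N (λ d → - f d)
  ∑-neg zero f = refl
  ∑-neg (suc N) f rewrite sym (∑-neg N f) = ℤP.neg-distrib-+ (∑ N f) (f (suc N))

  ∑-truncate : ∀ M N {f : ℕ → ℤ} → M ℕ.≤ N → (∀ d → M ℕ.< d → d ℕ.≤ N → f d ≡ + 0) →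
               ∑ N f ≡ ∑ M f
  ∑-truncate M zero z≤n h = refl
  ∑-truncate M (suc N) M≤ h with M ℕP.≟ suc N
  ... | yes refl = refl
  ... | no M≢ = trans (cong₂ _+_ (∑-truncate M N M≤N (λ d p q → h d p (ℕP.m≤n⇒m≤1+n q)))
                                   (h (suc N) (s≤s M≤N) ℕP.≤-refl))
                      (ℤP.+-identityʳ _)
    where M≤N = ℕP.≤-pred (ℕP.≤∧≢⇒< M≤ M≢)

  ∑-swap : ∀ N M (f : ℕ → ℕ → ℤ) →
           ∑ N (λ d → ∑ M (λ e → f d e)) ≡ ∑ M (λ e → ∑ N (λ d → f d e))
  ∑-swap zero M f = sym (∑-zero M (λ _ _ _ → refl))
  ∑-swap (suc N) M f rewrite ∑-swap N M f = sym (∑-+ M (λ e → ∑ N (λ d → f d e)) (f (suc N)))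

  ∑-split : ∀ N L (f : ℕ → ℤ) → ∑ (N ℕ.+ L) f ≡ ∑ N f + ∑ L (λ r → f (N ℕ.+ r))
  ∑-split N zero f rewrite ℕP.+-identityʳ N = sym (ℤP.+-identityʳ _)
  ∑-split N (suc L) f rewrite ℕP.+-suc N L | ∑-split N L f = ℤP.+-assoc (∑ N f) _ _

  ∑-delta : ∀ N v (g : ℕ → ℤ) → 1 ℕ.≤ v → v ℕ.≤ N → ∑ N (λ d → 𝟙 (does (d ℕP.≟ v)) * g d) ≡ g v
  ∑-delta zero .zero g () z≤n
  ∑-delta (suc N) v g 1≤v v≤N with v ℕP.≟ suc N
  ... | yes refl = begin
    ∑ N (λ d → 𝟙 (does (d ℕP.≟ suc N)) * g d) + 𝟙 (does (suc N ℕP.≟ suc N)) * g (suc N)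
      ≡⟨ cong₂ _+_ (∑-zero N off) (cong (λ b → 𝟙 b * g (suc N)) (dec-true (suc N ℕP.≟ suc N) refl)) ⟩
    + 0 + + 1 * g (suc N)
      ≡⟨ trans (ℤP.+-identityˡ _) (ℤP.*-identityˡ _) ⟩
    g (suc N) ∎
    where
    open ≡-Reasoning
    off : ∀ d → 1 ℕ.≤ d → d ℕ.≤ N → 𝟙 (does (d ℕP.≟ suc N)) * g d ≡ + 0
    off d _ d≤N rewrite dec-false (d ℕP.≟ suc N) (λ { refl → ℕP.<⇒≱ ℕP.≤-refl d≤N }) = refl
  ... | no v≢ rewrite ∑-delta N v g 1≤v (ℕP.≤-pred (ℕP.≤∧≢⇒< v≤N v≢))
                    | dec-false (suc N ℕP.≟ v) (λ e → v≢ (sym e)) = ℤP.+-identityʳ _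

  sumℤ-++ : ∀ (l m : List ℤ) → sumℤ (l ++ m) ≡ sumℤ l + sumℤ m
  sumℤ-++ [] m = sym (ℤP.+-identityˡ _)
  sumℤ-++ (a ∷ l) m rewrite sumℤ-++ l m = sym (ℤP.+-assoc a _ _)

  sumℤ-cong : ∀ {A : Set} (f g : A → ℤ) (l : List A) → (∀ a → a ∈ l → f a ≡ g a) →
              sumℤ (map f l) ≡ sumℤ (map g l)
  sumℤ-cong f g [] h = refl
  sumℤ-cong f g (a ∷ l) h = cong₂ _+_ (h a (here refl)) (sumℤ-cong f g l (λ b b∈ → h b (there b∈)))

  sumℤ-zero : ∀ {A : Set} {f : A → ℤ} (l : List A) → (∀ a → a ∈ l → f a ≡ + 0) → sumℤ (map f l) ≡ + 0
  sumℤ-zero [] h = refl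
  sumℤ-zero (a ∷ l) h rewrite h a (here refl) | sumℤ-zero l (λ b b∈ → h b (there b∈)) = refl

  sumℤ-*ˡ : ∀ {A : Set} (c : ℤ) (f : A → ℤ) (l : List A) →
            c * sumℤ (map f l) ≡ sumℤ (map (λ a → c * f a) l)
  sumℤ-*ˡ c f [] = ℤP.*-zeroʳ c
  sumℤ-*ˡ c f (a ∷ l) rewrite sym (sumℤ-*ˡ c f l) = ℤP.*-distribˡ-+ c (f a) _

  sumℤ-filter : ∀ {A : Set} {P : A → Set} (P? : Decidable P) (f : A → ℤ) (l : List A) →
    sumℤ (map f (filter P? l)) ≡ sumℤ (map (λ a → 𝟙 (does (P? a)) * f a) l)
  sumℤ-filter P? f [] = refl
  sumℤ-filter P? f (a ∷ l) with does (P? a)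
  ... | true = cong₂ _+_ (sym (ℤP.*-identityˡ (f a))) (sumℤ-filter P? f l)
  ... | false = trans (sumℤ-filter P? f l)
                      (sym (trans (cong (_+ sumℤ (map (λ b → 𝟙 (does (P? b)) * f b) l)) (ℤP.*-zeroˡ (f a)))
                                  (ℤP.+-identityˡ _)))

  sumℤ-filterᵇ : ∀ {A : Set} (p : A → Bool) (f : A → ℤ) (l : List A) →
    sumℤ (map f (filterᵇ p l)) ≡ sumℤ (map (λ a → 𝟙 (p a) * f a) l)
  sumℤ-filterᵇ p = sumℤ-filter (T? ∘ p)
    where open import Function using (_∘_)

  sumℤ-oneTo : ∀ N (f : ℕ → ℤ) → sumℤ (map f (oneTo N)) ≡ ∑ N f
  sumℤ-oneTo zero f = refl
  sumℤ-oneTo (suc N) f = begin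
    sumℤ (map f (map suc (upTo (suc N))))
      ≡⟨ cong (λ l → sumℤ (map f (map suc l))) (sym (LP.upTo-∷ʳ N)) ⟩
    sumℤ (map f (map suc (upTo N ++ [ N ])))
      ≡⟨ cong (λ l → sumℤ (map f l)) (LP.map-++ suc (upTo N) [ N ]) ⟩
    sumℤ (map f (oneTo N ++ [ suc N ]))
      ≡⟨ cong sumℤ (LP.map-++ f (oneTo N) [ suc N ]) ⟩
    sumℤ (map f (oneTo N) ++ [ f (suc N) ])
      ≡⟨ sumℤ-++ (map f (oneTo N)) _ ⟩
    sumℤ (map f (oneTo N)) + (f (suc N) + + 0)
      ≡⟨ cong₂ _+_ (sumℤ-oneTo N f) (ℤP.+-identityʳ _) ⟩
    ∑ (suc N) f ∎
    where open ≡-Reasoning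

  sumℤ-∑-swap : ∀ {A : Set} N (f : A → ℕ → ℤ) (l : List A) →
    sumℤ (map (λ a → ∑ N (f a)) l) ≡ ∑ N (λ d → sumℤ (map (λ a → f a d) l))
  sumℤ-∑-swap N f [] = sym (∑-zero N (λ _ _ _ → refl))
  sumℤ-∑-swap N f (a ∷ l) rewrite sumℤ-∑-swap N f l = sym (∑-+ N (f a) _)

  sumℕ-ℤ : ∀ {A : Set} (f : A → ℕ) (l : List A) → + sumℕ (map f l) ≡ sumℤ (map (λ a → + f a) l)
  sumℕ-ℤ f [] = refl
  sumℕ-ℤ f (a ∷ l) rewrite sym (sumℕ-ℤ f l) = sym (ℤP.pos-+ (f a) _)

  length-filter : ∀ {A : Set} {P : A → Set} (P? : Decidable P) (l : List A) →
    + length (filter P? l) ≡ sumℤ (map (λ a → 𝟙 (does (P? a))) l)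
  length-filter P? [] = refl
  length-filter P? (a ∷ l) with does (P? a)
  ... | true rewrite sym (length-filter P? l) = refl
  ... | false = trans (length-filter P? l) (sym (ℤP.+-identityˡ _))

  countValue : ∀ {A : Set} → List A → (A → ℕ) → ℕ → ℤ
  countValue L g d = sumℤ (map (λ a → 𝟙 (does (d ℕP.≟ g a))) L)

  sumℤ-byValue : ∀ {A : Set} N (g : A → ℕ) (G : ℕ → ℤ) (L : List A) →
    All (λ a → 1 ℕ.≤ g a × g a ℕ.≤ N) L →
    sumℤ (map (λ a → G (g a)) L) ≡ ∑ N (λ d → countValue L g d * G d)
  sumℤ-byValue N g G [] [] = sym (∑-zero N (λ d _ _ → ℤP.*-zeroˡ (G d)))
  sumℤ-byValue N g G (a ∷ L) ((ga≥1 , ga≤N) ∷ rest) = begin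
    G (g a) + sumℤ (map (λ b → G (g b)) L)
      ≡⟨ cong₂ _+_ (sym (∑-delta N (g a) G ga≥1 ga≤N)) (sumℤ-byValue N g G L rest) ⟩
    ∑ N (λ d → 𝟙 (does (d ℕP.≟ g a)) * G d) + ∑ N (λ d → countValue L g d * G d)
      ≡⟨ sym (∑-+ N _ _) ⟩
    ∑ N (λ d → 𝟙 (does (d ℕP.≟ g a)) * G d + countValue L g d * G d)
      ≡⟨ ∑-cong N (λ d _ _ → sym (ℤP.*-distribʳ-+ (G d) (𝟙 (does (d ℕP.≟ g a))) (countValue L g d))) ⟩
    ∑ N (λ d → countValue (a ∷ L) g d * G d) ∎
    where open ≡-Reasoning

  countValue-unique : ∀ {A : Set} (g : A → ℕ) → Injective _≡_ _≡_ g →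
                      ∀ L a → Unique L → a ∈ L → countValue L g (g a) ≡ + 1
  countValue-unique g inj (a ∷ L) .a (a∉L ∷ _) (here refl)
    rewrite dec-true (g a ℕP.≟ g a) refl =
    cong (λ z → + 1 + z) (sumℤ-zero L (λ b b∈L → cong 𝟙 (dec-false (g a ℕP.≟ g b) (λ ga≡gb → All.lookup a∉L b∈L (inj ga≡gb)))))
  countValue-unique g inj (b ∷ L) a (b∉L ∷ uniq) (there a∈L)
    rewrite dec-false (g a ℕP.≟ g b) (λ ga≡gb → All.lookup b∉L a∈L (sym (inj ga≡gb))) =
    trans (ℤP.+-identityˡ _) (countValue-unique g inj L a uniq a∈L)

-- The Möbius function of Defs: μ(d·p) = -μ(d) for a prime p ∤ d and
-- μ(d·p) = 0 for a prime p ∣ d.  These two recurrences are all that the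
-- divisor-sum identities below use about μ.
module Mobius where

  open import Data.Nat as ℕ using (zero; suc; z≤n; s≤s)
  import Data.Nat.Properties as ℕP
  open import Data.Nat.Divisibility
  open import Data.Nat.Primality
  open import Data.Nat.Coprimality using (Coprime; coprime-divisor)
  open import Data.Integer as ℤ using (ℤ; -_)
  import Data.Integer.Properties as ℤP
  open import Data.Bool using (Bool; true; false; _∧_; _∨_)
  import Data.Bool.Properties as BP
  open import Data.List using (foldr; upTo)
  open import Data.List.Membership.Propositional.Properties using (∈-upTo⁺)
  open import Data.List.Relation.Unary.Any using (here; there)
  open import Data.Product using (∃)
  open import Data.Sum using (inj₁; inj₂)
  open import Data.Empty using (⊥-elim)
  open import Relation.Binary.PropositionalEquality
  open import Relation.Nullary using (yes; no; does; ¬_; _×-dec_)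
  open import Relation.Nullary.Decidable using (dec-true; dec-false)
  open import Function using (case_of_)
  open FiniteSums

  foldr∨-intro : ∀ {A : Set} (f : A → Bool) (l : List A) a → a ∈ l → f a ≡ true →
                 foldr (λ k b → f k ∨ b) false l ≡ true
  foldr∨-intro f (b ∷ l) a (here refl) fa rewrite fa = refl
  foldr∨-intro f (b ∷ l) a (there a∈) fa rewrite foldr∨-intro f l a a∈ fa = BP.∨-zeroʳ (f b)

  foldr∨-elim : ∀ {A : Set} (f : A → Bool) (l : List A) →
                foldr (λ k b → f k ∨ b) false l ≡ true → ∃ λ a → a ∈ l × f a ≡ true
  foldr∨-elim f (b ∷ l) h with f b in eq
  ... | true = b , here refl , eq
  ... | false = let (a , a∈ , fa) = foldr∨-elim f l h in a , there a∈ , fa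

  square∣⇒hasSquareFactor : ∀ n k → 0 ℕ.< n → 2 ℕ.≤ k → k ℕ.* k ∣ n → hasSquareFactor n ≡ true
  square∣⇒hasSquareFactor n (suc zero) n>0 (s≤s ()) kk∣n
  square∣⇒hasSquareFactor n (suc (suc k)) n>0 _ kk∣n =
    foldr∨-intro (λ k → does (suc (suc k) ℕ.* suc (suc k) ∣? n)) (upTo n) k
      (∈-upTo⁺ k<n) (dec-true (_ ∣? n) kk∣n)
    where
    instance _ = ℕ.>-nonZero n>0
    k<n : k ℕ.< n
    k<n = ℕP.<-≤-trans (ℕP.≤-trans (ℕP.n<1+n k) (ℕP.n≤1+n (suc k)))
            (ℕP.≤-trans (ℕP.m≤m*n (suc (suc k)) (suc (suc k))) (∣⇒≤ kk∣n))

  hasSquareFactor⇒square∣ : ∀ n → hasSquareFactor n ≡ true → ∃ λ k → 2 ℕ.≤ k × k ℕ.* k ∣ n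
  hasSquareFactor⇒square∣ n h with foldr∨-elim (λ k → does (suc (suc k) ℕ.* suc (suc k) ∣? n)) (upTo n) h
  ... | k , _ , e = suc (suc k) , s≤s (s≤s z≤n) , does⇒ (_ ∣? n) e

  prime≥2 : ∀ {p} → Prime p → 2 ℕ.≤ p
  prime≥2 {p} pp = ℕ.nonTrivial⇒n>1 p {{prime⇒nonTrivial pp}}

  prime>0 : ∀ {p} → Prime p → 0 ℕ.< p
  prime>0 pp = ℕP.<-trans (s≤s z≤n) (prime≥2 pp)

  prime∣prime⇒≡ : ∀ {r p} → Prime r → Prime p → r ∣ p → r ≡ p
  prime∣prime⇒≡ pr pp r∣p with prime⇒irreducible pp r∣p
  ... | inj₁ refl = case prime≥2 pr of λ { (s≤s ()) }
  ... | inj₂ e = e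

  isPrimeDivisor : ℕ → ℕ → Bool
  isPrimeDivisor n r = does (prime? r) ∧ does (r ∣? n)

  numPrimeDivisors-∑ : ∀ n N → 0 ℕ.< n → n ℕ.≤ N → + numPrimeDivisors n ≡ ∑ N (λ r → 𝟙 (isPrimeDivisor n r))
  numPrimeDivisors-∑ n N n>0 n≤N = begin
    + numPrimeDivisors n
      ≡⟨ length-filter (λ p → prime? p ×-dec (p ∣? n)) (oneTo n) ⟩
    sumℤ (map (λ r → 𝟙 (isPrimeDivisor n r)) (oneTo n)) ≡⟨ sumℤ-oneTo n _ ⟩
    ∑ n (λ r → 𝟙 (isPrimeDivisor n r))                  ≡⟨ sym (∑-truncate n N n≤N beyond) ⟩
    ∑ N (λ r → 𝟙 (isPrimeDivisor n r))                  ∎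
    where
    open ≡-Reasoning
    instance _ = ℕ.>-nonZero n>0
    beyond : ∀ d → n ℕ.< d → d ℕ.≤ N → 𝟙 (isPrimeDivisor n d) ≡ + 0
    beyond d n<d _ rewrite dec-false (d ∣? n) (λ d∣n → ℕP.<⇒≱ n<d (∣⇒≤ d∣n))
                         | BP.∧-zeroʳ (does (prime? d)) = refl

  isPrimeDivisor-*p : ∀ d p → Prime p → ¬ (p ∣ d) → ∀ r →
    𝟙 (isPrimeDivisor (d ℕ.* p) r) ≡ 𝟙 (isPrimeDivisor d r) + 𝟙 (does (r ℕP.≟ p))
  isPrimeDivisor-*p d p pp p∤d r with r ℕP.≟ p
  ... | yes refl rewrite dec-true (r ℕP.≟ r) refl | dec-true (prime? r) pp
                       | dec-true (r ∣? d ℕ.* r) (n∣m*n d) | dec-false (r ∣? d) p∤d = refl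
  ... | no r≢p rewrite dec-false (r ℕP.≟ p) r≢p with prime? r
  ...   | no _ = refl
  ...   | yes pr =
    trans (cong 𝟙 (Bool-ext {does (r ∣? d ℕ.* p)} {does (r ∣? d)} to from)) (sym (ℤP.+-identityʳ _))
    where
    to : does (r ∣? d ℕ.* p) ≡ true → does (r ∣? d) ≡ true
    to h with euclidsLemma d p pr (does⇒ (r ∣? d ℕ.* p) h)
    ... | inj₁ r∣d = dec-true (r ∣? d) r∣d
    ... | inj₂ r∣p = ⊥-elim (r≢p (prime∣prime⇒≡ pr pp r∣p))
    from : does (r ∣? d) ≡ true → does (r ∣? d ℕ.* p) ≡ true
    from h = dec-true (r ∣? d ℕ.* p) (∣m⇒∣m*n p (does⇒ (r ∣? d) h))

  numPrimeDivisors-*p : ∀ d p → 0 ℕ.< d → Prime p → ¬ (p ∣ d) →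
                        numPrimeDivisors (d ℕ.* p) ≡ suc (numPrimeDivisors d)
  numPrimeDivisors-*p d p d>0 pp p∤d = ℤP.+-injective (begin
    + numPrimeDivisors (d ℕ.* p)
      ≡⟨ numPrimeDivisors-∑ (d ℕ.* p) N (ℕP.*-mono-< d>0 (prime>0 pp)) ℕP.≤-refl ⟩
    ∑ N (λ r → 𝟙 (isPrimeDivisor (d ℕ.* p) r))
      ≡⟨ ∑-cong N (λ r _ _ → isPrimeDivisor-*p d p pp p∤d r) ⟩
    ∑ N (λ r → 𝟙 (isPrimeDivisor d r) + 𝟙 (does (r ℕP.≟ p)))
      ≡⟨ ∑-+ N _ _ ⟩
    ∑ N (λ r → 𝟙 (isPrimeDivisor d r)) + ∑ N (λ r → 𝟙 (does (r ℕP.≟ p)))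
      ≡⟨ cong₂ _+_ (sym (numPrimeDivisors-∑ d N d>0 d≤N)) onlyP ⟩
    + numPrimeDivisors d + + 1
      ≡⟨ ℤP.+-comm (+ numPrimeDivisors d) (+ 1) ⟩
    + suc (numPrimeDivisors d) ∎)
    where
    open ≡-Reasoning
    N = d ℕ.* p
    d≤N : d ℕ.≤ N
    d≤N = ℕP.m≤m*n d p {{ℕ.>-nonZero (prime>0 pp)}}
    onlyP : ∑ N (λ r → 𝟙 (does (r ℕP.≟ p))) ≡ + 1
    onlyP = trans (∑-cong N (λ r _ _ → sym (ℤP.*-identityʳ (𝟙 (does (r ℕP.≟ p))))))
                  (∑-delta N p (λ _ → + 1) (prime>0 pp) (ℕP.m≤n*m p d {{ℕ.>-nonZero d>0}}))

  -- for p ∤ d, d·p has a square factor iff d has one (a square factor of d·p is coprime to p)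
  hasSquareFactor-*p : ∀ d p → 0 ℕ.< d → Prime p → ¬ (p ∣ d) →
                       hasSquareFactor (d ℕ.* p) ≡ hasSquareFactor d
  hasSquareFactor-*p d p d>0 pp p∤d = Bool-ext to from
    where
    instance _ = ℕ.>-nonZero (prime>0 pp)
    to : hasSquareFactor (d ℕ.* p) ≡ true → hasSquareFactor d ≡ true
    to h with hasSquareFactor⇒square∣ (d ℕ.* p) h
    ... | k , k≥2 , kk∣dp with p ∣? k
    ...   | yes p∣k = ⊥-elim (p∤d (*-cancelʳ-∣ p (∣-trans (*-pres-∣ p∣k p∣k) kk∣dp)))
    ...   | no p∤k = square∣⇒hasSquareFactor d k d>0 k≥2
                       (coprime-divisor kk⊥p (subst (k ℕ.* k ∣_) (ℕP.*-comm d p) kk∣dp))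
      where
      kk⊥p : Coprime (k ℕ.* k) p
      kk⊥p (i∣kk , i∣p) with prime⇒irreducible pp i∣p
      ... | inj₁ i≡1 = i≡1
      ... | inj₂ refl with euclidsLemma k k pp i∣kk
      ...   | inj₁ p∣k = ⊥-elim (p∤k p∣k)
      ...   | inj₂ p∣k = ⊥-elim (p∤k p∣k)
    from : hasSquareFactor d ≡ true → hasSquareFactor (d ℕ.* p) ≡ true
    from h with hasSquareFactor⇒square∣ d h
    ... | k , k≥2 , kk∣d =
      square∣⇒hasSquareFactor (d ℕ.* p) k (ℕP.*-mono-< d>0 (prime>0 pp)) k≥2 (∣m⇒∣m*n p kk∣d)

  μ-*p : ∀ d p → 0 ℕ.< d → Prime p → ¬ (p ∣ d) → μ (d ℕ.* p) ≡ - μ d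
  μ-*p d p d>0 pp p∤d = unfold (hasSquareFactor-*p d p d>0 pp p∤d) (numPrimeDivisors-*p d p d>0 pp p∤d)
    where
    unfold : hasSquareFactor (d ℕ.* p) ≡ hasSquareFactor d →
             numPrimeDivisors (d ℕ.* p) ≡ suc (numPrimeDivisors d) → μ (d ℕ.* p) ≡ - μ d
    unfold e₁ e₂ with hasSquareFactor d
    ... | true rewrite e₁ = refl
    ... | false rewrite e₁ | e₂ = refl

  μ-*p-zero : ∀ d p → 0 ℕ.< d → Prime p → p ∣ d → μ (d ℕ.* p) ≡ + 0
  μ-*p-zero d p d>0 pp p∣d
    rewrite square∣⇒hasSquareFactor (d ℕ.* p) p (ℕP.*-mono-< d>0 (prime>0 pp)) (prime≥2 pp) (*-monoˡ-∣ p p∣d)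
    = refl

module DivisorSums where

  open import Data.Nat as ℕ using (zero; suc; z≤n; s≤s)
  import Data.Nat.Properties as ℕP
  open import Data.Nat.Divisibility
  open import Data.Nat.GCD
  open import Data.Nat.Primality using (Prime; euclidsLemma)
  open import Data.Nat.Primality.Factorisation using (factorise; PrimeFactorisation)
  open import Data.Nat.ListAction using (product)
  open import Data.Integer as ℤ using (ℤ; -_)
  import Data.Integer.Properties as ℤP
  open import Data.Integer.Tactic.RingSolver using (solve-∀)
  open import Data.Bool using (Bool; true; false; _∧_; not)
  open import Data.List.Relation.Unary.All using (All; _∷_)
  open import Data.Product using (∃; proj₁; proj₂)
  open import Data.Sum using (inj₁; inj₂)
  open import Data.Empty using (⊥-elim)
  open import Relation.Binary.PropositionalEquality
  open import Relation.Nullary using (yes; no; does; ¬_)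
  open import Relation.Nullary.Decidable using (dec-true; dec-false)
  open FiniteSums
  open Mobius

  𝟙-≤-suc : ∀ m N → 𝟙 (does (m ℕP.≤? suc N)) ≡ 𝟙 (does (m ℕP.≤? N)) + 𝟙 (does (m ℕP.≟ suc N))
  𝟙-≤-suc m N with m ℕP.≤? N
  ... | yes m≤N rewrite dec-true (m ℕP.≤? N) m≤N | dec-true (m ℕP.≤? suc N) (ℕP.m≤n⇒m≤1+n m≤N)
                      | dec-false (m ℕP.≟ suc N) (λ { refl → ℕP.<⇒≱ ℕP.≤-refl m≤N }) = refl
  ... | no m≰N rewrite dec-false (m ℕP.≤? N) m≰N with m ℕP.≟ suc N
  ...   | yes refl rewrite dec-true (suc N ℕP.≤? suc N) ℕP.≤-refl | dec-true (N ℕP.≟ N) refl = refl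
  ...   | no m≢ rewrite dec-false (m ℕP.≤? suc N) (λ m≤ → m≢ (ℕP.≤-antisym m≤ (ℕP.≰⇒> m≰N)))
                      | dec-false (m ℕP.≟ suc N) m≢ = refl

  ∑-exactMultiple : ∀ e → 0 ℕ.< e → ∀ M m (h : ℕ → ℤ) → 1 ℕ.≤ m → m ℕ.≤ M →
    ∑ M (λ d → 𝟙 (does (d ℕ.* e ℕP.≟ m)) * h (d ℕ.* e)) ≡ 𝟙 (does (e ∣? m)) * h m
  ∑-exactMultiple e e>0 M m h m≥1 m≤M with e ∣? m
  ... | yes (divides q m≡qe) = begin
      ∑ M (λ d → 𝟙 (does (d ℕ.* e ℕP.≟ m)) * h (d ℕ.* e))
        ≡⟨ ∑-cong M (λ d _ _ → cong (λ b → 𝟙 b * h (d ℕ.* e)) (Bool-ext (to d) (from d))) ⟩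
      ∑ M (λ d → 𝟙 (does (d ℕP.≟ q)) * h (d ℕ.* e))
        ≡⟨ ∑-delta M q (λ d → h (d ℕ.* e)) q≥1 (ℕP.≤-trans q≤m m≤M) ⟩
      h (q ℕ.* e)       ≡⟨ cong h (sym m≡qe) ⟩
      h m               ≡⟨ sym (ℤP.*-identityˡ _) ⟩
      + 1 * h m ∎
    where
    open ≡-Reasoning
    instance _ = ℕ.>-nonZero e>0
    to : ∀ d → does (d ℕ.* e ℕP.≟ m) ≡ true → does (d ℕP.≟ q) ≡ true
    to d t = dec-true (d ℕP.≟ q) (ℕP.*-cancelʳ-≡ d q e (trans (does⇒ (d ℕ.* e ℕP.≟ m) t) m≡qe))
    from : ∀ d → does (d ℕP.≟ q) ≡ true → does (d ℕ.* e ℕP.≟ m) ≡ true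
    from d t = dec-true (d ℕ.* e ℕP.≟ m) (trans (cong (ℕ._* e) (does⇒ (d ℕP.≟ q) t)) (sym m≡qe))
    q≥1 : 1 ℕ.≤ q
    q≥1 = ℕP.n≢0⇒n>0 (λ { refl → ℕP.<⇒≱ m≥1 (ℕP.≤-reflexive m≡qe) })
    q≤m : q ℕ.≤ m
    q≤m = subst (q ℕ.≤_) (sym m≡qe) (ℕP.m≤m*n q e)
  ... | no e∤m = trans (∑-zero M vanish) (sym (ℤP.*-zeroˡ (h m)))
    where
    vanish : ∀ d → 1 ℕ.≤ d → d ℕ.≤ M → 𝟙 (does (d ℕ.* e ℕP.≟ m)) * h (d ℕ.* e) ≡ + 0
    vanish d _ _ rewrite dec-false (d ℕ.* e ℕP.≟ m) (λ de≡m → e∤m (divides d (sym de≡m))) = refl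

  ∑-multiples : ∀ e → 0 ℕ.< e → ∀ N (h : ℕ → ℤ) →
    ∑ N (λ m → 𝟙 (does (e ∣? m)) * h m) ≡ ∑ N (λ d → 𝟙 (does (d ℕ.* e ℕP.≤? N)) * h (d ℕ.* e))
  ∑-multiples e e>0 zero h = refl
  ∑-multiples e e>0 (suc N) h = sym (begin
    ∑ (suc N) (λ d → 𝟙 (does (d ℕ.* e ℕP.≤? suc N)) * h (d ℕ.* e))
      ≡⟨ ∑-cong (suc N) (λ d _ _ → split d) ⟩
    ∑ (suc N) (λ d → 𝟙 (does (d ℕ.* e ℕP.≤? N)) * h (d ℕ.* e) + 𝟙 (does (d ℕ.* e ℕP.≟ suc N)) * h (d ℕ.* e))
      ≡⟨ ∑-+ (suc N) _ _ ⟩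
    ∑ N (λ d → 𝟙 (does (d ℕ.* e ℕP.≤? N)) * h (d ℕ.* e)) + 𝟙 (does (suc N ℕ.* e ℕP.≤? N)) * h (suc N ℕ.* e)
      + ∑ (suc N) (λ d → 𝟙 (does (d ℕ.* e ℕP.≟ suc N)) * h (d ℕ.* e))
      ≡⟨ cong₂ _+_ (cong₂ _+_ (sym (∑-multiples e e>0 N h)) tooLarge)
                   (∑-exactMultiple e e>0 (suc N) (suc N) h (s≤s z≤n) ℕP.≤-refl) ⟩
    ∑ N (λ m → 𝟙 (does (e ∣? m)) * h m) + + 0 + 𝟙 (does (e ∣? suc N)) * h (suc N)
      ≡⟨ cong (_+ 𝟙 (does (e ∣? suc N)) * h (suc N)) (ℤP.+-identityʳ (∑ N (λ m → 𝟙 (does (e ∣? m)) * h m))) ⟩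
    ∑ (suc N) (λ m → 𝟙 (does (e ∣? m)) * h m) ∎)
    where
    open ≡-Reasoning
    split : ∀ d → 𝟙 (does (d ℕ.* e ℕP.≤? suc N)) * h (d ℕ.* e)
                ≡ 𝟙 (does (d ℕ.* e ℕP.≤? N)) * h (d ℕ.* e) + 𝟙 (does (d ℕ.* e ℕP.≟ suc N)) * h (d ℕ.* e)
    split d = trans (cong (_* h (d ℕ.* e)) (𝟙-≤-suc (d ℕ.* e) N)) (ℤP.*-distribʳ-+ (h (d ℕ.* e)) (𝟙 (does (d ℕ.* e ℕP.≤? N))) (𝟙 (does (d ℕ.* e ℕP.≟ suc N))))
    tooLarge : 𝟙 (does (suc N ℕ.* e ℕP.≤? N)) * h (suc N ℕ.* e) ≡ + 0
    tooLarge rewrite dec-false (suc N ℕ.* e ℕP.≤? N)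
                       (λ le → ℕP.<⇒≱ ℕP.≤-refl (ℕP.≤-trans (ℕP.m≤m*n (suc N) e {{ℕ.>-nonZero e>0}}) le)) = refl

  countMultiples : ∀ d e → 0 ℕ.< e → ∑ (d ℕ.* e) (λ k → 𝟙 (does (e ∣? k))) ≡ + d
  countMultiples zero e e>0 = refl
  countMultiples (suc d) e e>0 = begin
    ∑ (e ℕ.+ d ℕ.* e) f                   ≡⟨ cong (λ n → ∑ n f) (ℕP.+-comm e (d ℕ.* e)) ⟩
    ∑ (d ℕ.* e ℕ.+ e) f                   ≡⟨ ∑-split (d ℕ.* e) e f ⟩
    ∑ (d ℕ.* e) f + ∑ e (λ r → f (d ℕ.* e ℕ.+ r)) ≡⟨ cong₂ _+_ (countMultiples d e e>0) lastBlock ⟩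
    + d + + 1                              ≡⟨ ℤP.+-comm (+ d) (+ 1) ⟩
    + suc d ∎
    where
    open ≡-Reasoning
    f : ℕ → ℤ
    f k = 𝟙 (does (e ∣? k))
    shift : ∀ r → f (d ℕ.* e ℕ.+ r) ≡ f r
    shift r = cong 𝟙 (Bool-ext
      (λ t → dec-true (e ∣? r) (∣m+n∣m⇒∣n (does⇒ (e ∣? _) t) (n∣m*n d)))
      (λ t → dec-true (e ∣? d ℕ.* e ℕ.+ r) (∣m∣n⇒∣m+n (n∣m*n d) (does⇒ (e ∣? r) t))))
    onlyLast : ∀ e → 0 ℕ.< e → ∑ e (λ r → 𝟙 (does (e ∣? r))) ≡ + 1
    onlyLast (suc e′) _ rewrite dec-true (suc e′ ∣? suc e′) ∣-refl =
      cong (_+ + 1) (∑-zero e′ (λ r r≥1 r≤e′ → cong 𝟙 (dec-false (suc e′ ∣? r)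
        (λ e∣r → ℕP.<⇒≱ (s≤s r≤e′) (∣⇒≤ {{ℕ.>-nonZero r≥1}} e∣r)))))
    lastBlock : ∑ e (λ r → f (d ℕ.* e ℕ.+ r)) ≡ + 1
    lastBlock = trans (∑-cong e (λ r _ _ → shift r)) (onlyLast e e>0)

  μ-divisorSum : ℕ → ℕ → ℤ
  μ-divisorSum N q = ∑ N (λ e → 𝟙 (does (e ∣? q)) * μ e)

  μ-divisorSum-truncate : ∀ N q → 0 ℕ.< q → q ℕ.≤ N → μ-divisorSum N q ≡ μ-divisorSum q q
  μ-divisorSum-truncate N q q>0 q≤N = ∑-truncate q N q≤N beyond
    where
    beyond : ∀ d → q ℕ.< d → d ℕ.≤ N → 𝟙 (does (d ∣? q)) * μ d ≡ + 0
    beyond d q<d _ rewrite dec-false (d ∣? q) (λ d∣q → ℕP.<⇒≱ q<d (∣⇒≤ {{ℕ.>-nonZero q>0}} d∣q)) = refl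

  primeDivisor : ∀ q → 2 ℕ.≤ q → ∃ λ p → Prime p × p ∣ q
  primeDivisor q q≥2 = first (PrimeFactorisation.factors pf) (PrimeFactorisation.isFactorisation pf)
                             (PrimeFactorisation.factorsPrime pf)
    where
    pf = factorise q {{ℕ.>-nonZero (ℕP.<-trans (s≤s z≤n) q≥2)}}
    first : ∀ fs → q ≡ product fs → All Prime fs → ∃ λ p → Prime p × p ∣ q
    first [] q≡1 _ = ⊥-elim (ℕP.<⇒≢ q≥2 (sym q≡1))
    first (p ∷ fs) q≡ (pp ∷ _) = p , pp , subst (p ∣_) (sym q≡) (m∣m*n (product fs))

  *-∣-prime : ∀ d p q → Prime p → ¬ (p ∣ d) → d ∣ q → p ∣ q → d ℕ.* p ∣ q
  *-∣-prime d p q pp p∤d (divides o q≡od) p∣q with euclidsLemma o d pp (subst (p ∣_) q≡od p∣q)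
  ... | inj₂ p∣d = ⊥-elim (p∤d p∣d)
  ... | inj₁ (divides o′ o≡o′p) = divides o′ (begin
    q               ≡⟨ q≡od ⟩
    o ℕ.* d          ≡⟨ cong (ℕ._* d) o≡o′p ⟩
    o′ ℕ.* p ℕ.* d    ≡⟨ ℕP.*-assoc o′ p d ⟩
    o′ ℕ.* (p ℕ.* d)  ≡⟨ cong (o′ ℕ.*_) (ℕP.*-comm p d) ⟩
    o′ ℕ.* (d ℕ.* p)  ∎)
    where open ≡-Reasoning

  -- for a prime p ∣ q, the divisor d·p of q cancels the divisor d when p ∤ d,
  -- and contributes nothing when p ∣ d
  μ-multipleOfPrime : ∀ q p → Prime p → p ∣ q → 0 ℕ.< q → ∀ d → 1 ℕ.≤ d →
    𝟙 (does (d ℕ.* p ℕP.≤? q)) * (𝟙 (does (d ℕ.* p ∣? q)) * μ (d ℕ.* p))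
      ≡ - (𝟙 (not (does (p ∣? d))) * (𝟙 (does (d ∣? q)) * μ d))
  μ-multipleOfPrime q p pp p∣q q>0 d d≥1 with p ∣? d
  ... | yes p∣d rewrite μ-*p-zero d p d≥1 pp p∣d | ℤP.*-zeroʳ (𝟙 (does (d ℕ.* p ∣? q))) =
    ℤP.*-zeroʳ (𝟙 (does (d ℕ.* p ℕP.≤? q)))
  ... | no p∤d rewrite μ-*p d p d≥1 pp p∤d with d ∣? q
  ...   | yes d∣q rewrite dec-true (d ℕ.* p ∣? q) (*-∣-prime d p q pp p∤d d∣q p∣q)
                        | dec-true (d ℕ.* p ℕP.≤? q) (∣⇒≤ {{ℕ.>-nonZero q>0}} (*-∣-prime d p q pp p∤d d∣q p∣q))
                        = units (μ d)
    where
    units : ∀ x → + 1 * (+ 1 * - x) ≡ - (+ 1 * (+ 1 * x))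
    units = solve-∀
  ...   | no d∤q rewrite dec-false (d ℕ.* p ∣? q) (λ dp∣q → d∤q (∣-trans (m∣m*n p) dp∣q)) =
    ℤP.*-zeroʳ (𝟙 (does (d ℕ.* p ℕP.≤? q)))

  möbius-divisorSum : ∀ q → 0 ℕ.< q → μ-divisorSum q q ≡ 𝟙 (does (q ℕP.≟ 1))
  möbius-divisorSum (suc zero) _ = refl
  möbius-divisorSum q@(suc (suc _)) _ = begin
    μ-divisorSum q q          ≡⟨ ∑-cong q (λ e _ _ → byP e) ⟩
    ∑ q (λ e → coprimeToP e + multipleOfP e) ≡⟨ ∑-+ q coprimeToP multipleOfP ⟩
    ∑ q coprimeToP + ∑ q multipleOfP       ≡⟨ cong (λ z → ∑ q coprimeToP + z) cancel ⟩
    ∑ q coprimeToP + - ∑ q coprimeToP      ≡⟨ ℤP.+-inverseʳ (∑ q coprimeToP) ⟩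
    + 0 ∎
    where
    open ≡-Reasoning
    p = proj₁ (primeDivisor q (s≤s (s≤s z≤n)))
    pp = proj₁ (proj₂ (primeDivisor q (s≤s (s≤s z≤n))))
    p∣q = proj₂ (proj₂ (primeDivisor q (s≤s (s≤s z≤n))))
    coprimeToP multipleOfP : ℕ → ℤ
    coprimeToP e = 𝟙 (not (does (p ∣? e))) * (𝟙 (does (e ∣? q)) * μ e)
    multipleOfP e = 𝟙 (does (p ∣? e)) * (𝟙 (does (e ∣? q)) * μ e)
    byP : ∀ e → 𝟙 (does (e ∣? q)) * μ e ≡ coprimeToP e + multipleOfP e
    byP e with does (p ∣? e)
    ... | true = sym (trans (cong (_+ (+ 1 * (𝟙 (does (e ∣? q)) * μ e))) (ℤP.*-zeroˡ (𝟙 (does (e ∣? q)) * μ e)))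
                            (trans (ℤP.+-identityˡ _) (ℤP.*-identityˡ _)))
    ... | false = sym (trans (ℤP.+-identityʳ _) (ℤP.*-identityˡ _))
    cancel : ∑ q multipleOfP ≡ - ∑ q coprimeToP
    cancel = begin
      ∑ q multipleOfP
        ≡⟨ ∑-multiples p (prime>0 pp) q (λ m → 𝟙 (does (m ∣? q)) * μ m) ⟩
      ∑ q (λ d → 𝟙 (does (d ℕ.* p ℕP.≤? q)) * (𝟙 (does (d ℕ.* p ∣? q)) * μ (d ℕ.* p)))
        ≡⟨ ∑-cong q (λ d d≥1 _ → μ-multipleOfPrime q p pp p∣q (s≤s z≤n) d d≥1) ⟩
      ∑ q (λ d → - coprimeToP d) ≡⟨ sym (∑-neg q coprimeToP) ⟩
      - ∑ q coprimeToP ∎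

  sumDivμ-∑ : ∀ q → sumDivμ q ≡ μ-divisorSum q q
  sumDivμ-∑ q = trans (sumℤ-filter (λ d → d ∣? q) μ (oneTo q)) (sumℤ-oneTo q _)

  sumDivμFrac-∑ : ∀ a b N → 0 ℕ.< a → 0 ℕ.< b → a ℕ.≤ N →
                  ∑ N (λ e → 𝟙 (does (e ℕ.* b ∣? a)) * μ e) ≡ sumDivμFrac a b
  sumDivμFrac-∑ a b N a>0 b>0 a≤N with b ∣? a
  ... | yes b∣a = begin
      ∑ N (λ e → 𝟙 (does (e ℕ.* b ∣? a)) * μ e)
        ≡⟨ ∑-cong N (λ e _ _ → cong (λ t → 𝟙 t * μ e) (Bool-ext (to e) (from e))) ⟩
      μ-divisorSum N q ≡⟨ μ-divisorSum-truncate N q q>0 (ℕP.≤-trans q≤a a≤N) ⟩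
      μ-divisorSum q q ≡⟨ sym (sumDivμ-∑ q) ⟩
      sumDivμ q ∎
    where
    open ≡-Reasoning
    instance _ = ℕ.>-nonZero b>0
    q = quotient b∣a
    a≡qb : a ≡ q ℕ.* b
    a≡qb = m∣n⇒n≡quotient*m b∣a
    to : ∀ e → does (e ℕ.* b ∣? a) ≡ true → does (e ∣? q) ≡ true
    to e t = dec-true (e ∣? q) (*-cancelʳ-∣ b (subst (e ℕ.* b ∣_) a≡qb (does⇒ (e ℕ.* b ∣? a) t)))
    from : ∀ e → does (e ∣? q) ≡ true → does (e ℕ.* b ∣? a) ≡ true
    from e t = dec-true (e ℕ.* b ∣? a) (subst (e ℕ.* b ∣_) (sym a≡qb) (*-monoˡ-∣ b (does⇒ (e ∣? q) t)))
    q>0 : 0 ℕ.< q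
    q>0 = ℕP.n≢0⇒n>0 (λ q≡0 → ℕP.<⇒≢ a>0 (sym (trans a≡qb (cong (ℕ._* b) q≡0))))
    q≤a : q ℕ.≤ a
    q≤a = subst (q ℕ.≤_) (sym a≡qb) (ℕP.m≤m*n q b)
  ... | no b∤a = ∑-zero N vanish
    where
    vanish : ∀ e → 1 ℕ.≤ e → e ℕ.≤ N → 𝟙 (does (e ℕ.* b ∣? a)) * μ e ≡ + 0
    vanish e _ _ rewrite dec-false (e ℕ.* b ∣? a) (λ eb∣a → b∤a (∣-trans (n∣m*n e) eb∣a)) = refl

  sumDivμFrac-≢ : ∀ a b → 0 ℕ.< a → a ≢ b → sumDivμFrac a b ≡ + 0
  sumDivμFrac-≢ a b a>0 a≢b with b ∣? a
  ... | no _ = refl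
  ... | yes b∣a = trans (sumDivμ-∑ q) (trans (möbius-divisorSum q q>0) (cong 𝟙 (dec-false (q ℕP.≟ 1) q≢1)))
    where
    q = quotient b∣a
    a≡qb : a ≡ q ℕ.* b
    a≡qb = m∣n⇒n≡quotient*m b∣a
    q>0 : 0 ℕ.< q
    q>0 = ℕP.n≢0⇒n>0 (λ q≡0 → ℕP.<⇒≢ a>0 (sym (trans a≡qb (cong (ℕ._* b) q≡0))))
    q≢1 : q ≢ 1
    q≢1 q≡1 = a≢b (trans a≡qb (trans (cong (ℕ._* b) q≡1) (ℕP.*-identityˡ b)))

  ∣?-gcd : ∀ m a b → does (m ∣? gcd a b) ≡ does (m ∣? a) ∧ does (m ∣? b)
  ∣?-gcd m a b = Bool-ext to from
    where
    to : does (m ∣? gcd a b) ≡ true → does (m ∣? a) ∧ does (m ∣? b) ≡ true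
    to t rewrite dec-true (m ∣? a) (∣-trans (does⇒ (m ∣? gcd a b) t) (gcd[m,n]∣m a b))
               | dec-true (m ∣? b) (∣-trans (does⇒ (m ∣? gcd a b) t) (gcd[m,n]∣n a b)) = refl
    from : does (m ∣? a) ∧ does (m ∣? b) ≡ true → does (m ∣? gcd a b) ≡ true
    from t with m ∣? a | m ∣? b
    ... | yes m∣a | yes m∣b = dec-true (m ∣? gcd a b) (gcd-greatest m∣a m∣b)

  -- φ(m) = Σ_{e ∣ m} μ(e)·#{k ≤ m : e ∣ k}: expand [gcd(k, m) = 1] by the
  -- Möbius identity and exchange the two sums
  φ-∑ : ∀ m → 0 ℕ.< m →
        + φ m ≡ ∑ m (λ e → (𝟙 (does (e ∣? m)) * μ e) * ∑ m (λ k → 𝟙 (does (e ∣? k))))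
  φ-∑ m m>0 = begin
    + φ m
      ≡⟨ length-filter (λ k → gcd k m ℕP.≟ 1) (oneTo m) ⟩
    sumℤ (map (λ k → 𝟙 (does (gcd k m ℕP.≟ 1))) (oneTo m))
      ≡⟨ sumℤ-oneTo m _ ⟩
    ∑ m (λ k → 𝟙 (does (gcd k m ℕP.≟ 1)))
      ≡⟨ ∑-cong m (λ k _ _ → coprimality k) ⟩
    ∑ m (λ k → ∑ m (λ e → 𝟙 (does (e ∣? k)) * (𝟙 (does (e ∣? m)) * μ e)))
      ≡⟨ ∑-swap m m _ ⟩
    ∑ m (λ e → ∑ m (λ k → 𝟙 (does (e ∣? k)) * (𝟙 (does (e ∣? m)) * μ e)))
      ≡⟨ ∑-cong m (λ e _ _ → trans (∑-cong m (λ k _ _ → ℤP.*-comm (𝟙 (does (e ∣? k))) (𝟙 (does (e ∣? m)) * μ e)))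
                                   (sym (∑-*ˡ m (𝟙 (does (e ∣? m)) * μ e) (λ k → 𝟙 (does (e ∣? k)))))) ⟩
    ∑ m (λ e → (𝟙 (does (e ∣? m)) * μ e) * ∑ m (λ k → 𝟙 (does (e ∣? k)))) ∎
    where
    open ≡-Reasoning
    coprimality : ∀ k → 𝟙 (does (gcd k m ℕP.≟ 1)) ≡ ∑ m (λ e → 𝟙 (does (e ∣? k)) * (𝟙 (does (e ∣? m)) * μ e))
    coprimality k = begin
      𝟙 (does (g ℕP.≟ 1)) ≡⟨ sym (möbius-divisorSum g g>0) ⟩
      μ-divisorSum g g   ≡⟨ sym (μ-divisorSum-truncate m g g>0 (gcd[m,n]≤n k m {{ℕ.>-nonZero m>0}})) ⟩
      μ-divisorSum m g
        ≡⟨ ∑-cong m (λ e _ _ → trans (cong (λ t → 𝟙 t * μ e) (∣?-gcd e k m))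
             (trans (cong (_* μ e) (𝟙-∧ (does (e ∣? k)) (does (e ∣? m))))
                    (ℤP.*-assoc (𝟙 (does (e ∣? k))) (𝟙 (does (e ∣? m))) (μ e)))) ⟩
      ∑ m (λ e → 𝟙 (does (e ∣? k)) * (𝟙 (does (e ∣? m)) * μ e)) ∎
      where
      g = gcd k m
      g>0 : 0 ℕ.< g
      g>0 = ℕP.n≢0⇒n>0 (λ g≡0 → ℕP.<⇒≢ m>0 (sym (gcd[m,n]≡0⇒n≡0 k g≡0)))

  -- for a set A ⊆ [1, N]:  Σ_{m ∈ A} φ(m) = Σ_{d ≤ N} d · Σ_{e ≤ N, e·d ∈ A} μ(e).
  -- Expand φ(m) by φ-∑, exchange the sums and write the multiples of e as d·e.
  ∑-φ : ∀ N (A : ℕ → Bool) → (∀ m → A m ≡ true → m ℕ.≤ N) →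
        ∑ N (λ m → 𝟙 (A m) * + φ m) ≡ ∑ N (λ d → + d * ∑ N (λ e → 𝟙 (A (e ℕ.* d)) * μ e))
  ∑-φ N A A≤N = begin
    ∑ N (λ m → 𝟙 (A m) * + φ m)
      ≡⟨ ∑-cong N φ-term ⟩
    ∑ N (λ m → ∑ N (λ e → 𝟙 (does (e ∣? m)) * H e m))
      ≡⟨ ∑-swap N N _ ⟩
    ∑ N (λ e → ∑ N (λ m → 𝟙 (does (e ∣? m)) * H e m))
      ≡⟨ ∑-cong N (λ e e≥1 _ → trans (∑-multiples e e≥1 N (H e)) (∑-cong N (λ d _ _ → multiple-term e d e≥1))) ⟩
    ∑ N (λ e → ∑ N (λ d → + d * (𝟙 (A (e ℕ.* d)) * μ e)))
      ≡⟨ ∑-swap N N _ ⟩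
    ∑ N (λ d → ∑ N (λ e → + d * (𝟙 (A (e ℕ.* d)) * μ e)))
      ≡⟨ ∑-cong N (λ d _ _ → sym (∑-*ˡ N (+ d) (λ e → 𝟙 (A (e ℕ.* d)) * μ e))) ⟩
    ∑ N (λ d → + d * ∑ N (λ e → 𝟙 (A (e ℕ.* d)) * μ e)) ∎
    where
    open ≡-Reasoning
    C : ℕ → ℕ → ℤ
    C e m = ∑ m (λ k → 𝟙 (does (e ∣? k)))
    H : ℕ → ℕ → ℤ
    H e m = (𝟙 (A m) * μ e) * C e m
    φ-term : ∀ m → 1 ℕ.≤ m → m ℕ.≤ N → 𝟙 (A m) * + φ m ≡ ∑ N (λ e → 𝟙 (does (e ∣? m)) * H e m)
    φ-term m m≥1 m≤N = begin
      𝟙 (A m) * + φ m         ≡⟨ cong (𝟙 (A m) *_) (φ-∑ m m≥1) ⟩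
      𝟙 (A m) * ∑ m F         ≡⟨ cong (𝟙 (A m) *_) (sym (∑-truncate m N m≤N beyond)) ⟩
      𝟙 (A m) * ∑ N F         ≡⟨ ∑-*ˡ N (𝟙 (A m)) F ⟩
      ∑ N (λ e → 𝟙 (A m) * F e) ≡⟨ ∑-cong N (λ e _ _ → rearrange (𝟙 (A m)) (𝟙 (does (e ∣? m))) (μ e) (C e m)) ⟩
      ∑ N (λ e → 𝟙 (does (e ∣? m)) * H e m) ∎
      where
      F : ℕ → ℤ
      F e = (𝟙 (does (e ∣? m)) * μ e) * C e m
      beyond : ∀ e → m ℕ.< e → e ℕ.≤ N → F e ≡ + 0
      beyond e m<e _ rewrite dec-false (e ∣? m) (λ e∣m → ℕP.<⇒≱ m<e (∣⇒≤ {{ℕ.>-nonZero m≥1}} e∣m)) = refl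
      rearrange : ∀ a b c d → a * ((b * c) * d) ≡ b * ((a * c) * d)
      rearrange = solve-∀
    multiple-term : ∀ e d → 1 ℕ.≤ e → 𝟙 (does (d ℕ.* e ℕP.≤? N)) * H e (d ℕ.* e) ≡ + d * (𝟙 (A (e ℕ.* d)) * μ e)
    multiple-term e d e≥1 rewrite ℕP.*-comm e d with A (d ℕ.* e) in de∈A
    ... | false = absent (𝟙 (does (d ℕ.* e ℕP.≤? N))) (μ e) (C e (d ℕ.* e)) (+ d)
      where
      absent : ∀ a b c d → a * ((+ 0 * b) * c) ≡ d * (+ 0 * b)
      absent = solve-∀
    ... | true rewrite dec-true (d ℕ.* e ℕP.≤? N) (A≤N (d ℕ.* e) de∈A) | countMultiples d e e≥1 =
      present (μ e) (+ d)
      where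
      present : ∀ b d → + 1 * ((+ 1 * b) * d) ≡ d * (+ 1 * b)
      present = solve-∀

module Sublists where

  open import Data.Nat.Divisibility using (divides)
  open import Data.Integer as ℤ using (ℤ; -_)
  open import Data.Integer.Tactic.RingSolver using (solve-∀)
  open import Data.Bool using (Bool; true; false; _∧_; not)
  open import Data.List using (_++_)
  import Data.List.Properties as LP
  open import Data.List.Membership.Propositional.Properties using (∈-++⁻; ∈-map⁻)
  open import Data.List.Relation.Unary.Any using (here; there)
  open import Data.List.Relation.Unary.All using (All; []; _∷_)
  open import Data.Sum using (inj₁; inj₂)
  open import Relation.Binary.PropositionalEquality
  open import Relation.Nullary using (does)
  open import Relation.Nullary.Decidable using (dec-true)
  open FiniteSums
  open DivisorSums using (∣?-gcd)

  allB-elim : ∀ {A : Set} (p : A → Bool) l → allB p l ≡ true → ∀ a → a ∈ l → p a ≡ true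
  allB-elim p (b ∷ l) h a a∈ with p b in pb
  allB-elim p (b ∷ l) h a (here refl) | true = pb
  allB-elim p (b ∷ l) h a (there a∈) | true = allB-elim p l h a a∈

  allB-intro : ∀ {A : Set} (p : A → Bool) l → (∀ a → a ∈ l → p a ≡ true) → allB p l ≡ true
  allB-intro p [] h = refl
  allB-intro p (b ∷ l) h rewrite h b (here refl) = allB-intro p l (λ a a∈ → h a (there a∈))

  inclusionExclusion : (Q : ℕ → Bool) (ys : List ℕ) →
    𝟙 (allB (λ y → not (Q y)) ys) ≡ sumℤ (map (λ T → neg1^ (length T) * 𝟙 (allB Q T)) (sublists ys))
  inclusionExclusion Q [] = refl
  inclusionExclusion Q (y ∷ ys) = begin
    𝟙 (not (Q y) ∧ allB (λ y → not (Q y)) ys)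
      ≡⟨ 𝟙-∧ (not (Q y)) _ ⟩
    𝟙 (not (Q y)) * 𝟙 (allB (λ y → not (Q y)) ys)
      ≡⟨ cong (𝟙 (not (Q y)) *_) (inclusionExclusion Q ys) ⟩
    𝟙 (not (Q y)) * R
      ≡⟨ complement (Q y) R ⟩
    - 𝟙 (Q y) * R + R
      ≡⟨ cong (_+ R) (trans (sumℤ-*ˡ (- 𝟙 (Q y)) F S) (sym withY)) ⟩
    sumℤ (map F (map (y ∷_) S)) + R
      ≡⟨ sym (sumℤ-++ (map F (map (y ∷_) S)) (map F S)) ⟩
    sumℤ (map F (map (y ∷_) S) ++ map F S)
      ≡⟨ cong sumℤ (sym (LP.map-++ F (map (y ∷_) S) S)) ⟩
    sumℤ (map F (map (y ∷_) S ++ S)) ∎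
    where
    open ≡-Reasoning
    F : List ℕ → ℤ
    F T = neg1^ (length T) * 𝟙 (allB Q T)
    S = sublists ys
    R = sumℤ (map F S)
    complement : ∀ b r → 𝟙 (not b) * r ≡ - 𝟙 b * r + r
    complement true = solve-∀
    complement false = solve-∀
    signs : ∀ a b c → - a * (b * c) ≡ - b * (a * c)
    signs = solve-∀
    consY : ∀ T → F (y ∷ T) ≡ - 𝟙 (Q y) * F T
    consY T = trans (cong (λ z → - neg1^ (length T) * z) (𝟙-∧ (Q y) (allB Q T)))
                    (signs (neg1^ (length T)) (𝟙 (Q y)) (𝟙 (allB Q T)))
    withY : sumℤ (map F (map (y ∷_) S)) ≡ sumℤ (map (λ T → - 𝟙 (Q y) * F T) S)
    withY = trans (cong sumℤ (sym (LP.map-∘ S))) (sumℤ-cong _ _ S (λ T _ → consY T))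

  ∣?-gcdList : ∀ m T → does (m ∣? gcdList T) ≡ allB (λ y → does (m ∣? y)) T
  ∣?-gcdList m [] = dec-true (m ∣? 0) (divides 0 refl)
  ∣?-gcdList m (y ∷ T) = trans (∣?-gcd m y (gcdList T)) (cong (does (m ∣? y) ∧_) (∣?-gcdList m T))

  sublists-All : ∀ {A : Set} {P : A → Set} ys → All P ys → ∀ T → T ∈ sublists ys → All P T
  sublists-All [] _ .[] (here refl) = []
  sublists-All (y ∷ ys) (py ∷ pys) T T∈ with ∈-++⁻ (map (y ∷_) (sublists ys)) T∈
  ... | inj₂ T∈′ = sublists-All ys pys T T∈′
  ... | inj₁ T∈y∷ with ∈-map⁻ (y ∷_) T∈y∷
  ...   | T′ , T′∈ , refl = py ∷ sublists-All ys pys T′ T′∈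

  sumℤ-sublists : ∀ (h : List ℕ → ℤ) ys →
    sumℤ (map h (sublists ys)) ≡ h [] + sumℤ (map h (filterᵇ isNonEmpty (sublists ys)))
  sumℤ-sublists h [] = refl
  sumℤ-sublists h (y ∷ ys) = begin
    sumℤ (map h (map (y ∷_) S ++ S))
      ≡⟨ trans (cong sumℤ (LP.map-++ h (map (y ∷_) S) S)) (sumℤ-++ (map h (map (y ∷_) S)) (map h S)) ⟩
    withY + sumℤ (map h S)
      ≡⟨ cong (λ z → withY + z) (sumℤ-sublists h ys) ⟩
    withY + (h [] + nonEmpty)
      ≡⟨ reorder withY (h []) nonEmpty ⟩
    h [] + (withY + nonEmpty)
      ≡⟨ cong (λ z → h [] + z) (sym (sumℤ-++ (map h (map (y ∷_) S)) (map h (filterᵇ isNonEmpty S)))) ⟩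
    h [] + sumℤ (map h (map (y ∷_) S) ++ map h (filterᵇ isNonEmpty S))
      ≡⟨ cong (λ l → h [] + sumℤ l) (sym (LP.map-++ h (map (y ∷_) S) (filterᵇ isNonEmpty S))) ⟩
    h [] + sumℤ (map h (map (y ∷_) S ++ filterᵇ isNonEmpty S))
      ≡⟨ cong (λ l → h [] + sumℤ (map h (l ++ filterᵇ isNonEmpty S))) (sym (consNonEmpty S)) ⟩
    h [] + sumℤ (map h (filterᵇ isNonEmpty (map (y ∷_) S) ++ filterᵇ isNonEmpty S))
      ≡⟨ cong (λ l → h [] + sumℤ (map h l)) (sym (LP.filter-++ _ (map (y ∷_) S) S)) ⟩
    h [] + sumℤ (map h (filterᵇ isNonEmpty (map (y ∷_) S ++ S))) ∎
    where
    open ≡-Reasoning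
    S = sublists ys
    withY = sumℤ (map h (map (y ∷_) S))
    nonEmpty = sumℤ (map h (filterᵇ isNonEmpty S))
    reorder : ∀ a c b → a + (c + b) ≡ c + (a + b)
    reorder = solve-∀
    consNonEmpty : ∀ Ts → filterᵇ isNonEmpty (map (y ∷_) Ts) ≡ map (y ∷_) Ts
    consNonEmpty [] = refl
    consNonEmpty (T ∷ Ts) = cong ((y ∷ T) ∷_) (consNonEmpty Ts)

-- A is the set of m with
-- m ∣ X and m ∤ x_t for every x_t < X (so α_j = Σ_{m ∈ A} φ(m)), and
-- c′ d = Σ_{e·d ∈ A} μ(e) extends c_ij = c′ x_i to every d.
module GcdClosedSet (n : ℕ) (x : Fin n → ℕ) (pos : ∀ k → 0 < x k) (gc : GcdClosed x)
                    (j : Fin n) (ys : List ℕ)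
                    (gtd : ∀ z → (z ∈ ys) ⇔ IsGreatestTypeDivisor x z (x j)) where

  open import Data.Nat as ℕ using (zero; suc; _∸_; _≤_)
  import Data.Nat.Properties as ℕP
  open import Data.Nat.Divisibility
  open import Data.Nat.GCD
  open import Data.Integer as ℤ using (ℤ)
  import Data.Integer.Properties as ℤP
  open import Data.Integer.Tactic.RingSolver using (solve-∀)
  open import Data.Bool using (Bool; true; false; _∧_; not; if_then_else_)
  import Data.Fin.Properties as FinP
  open import Data.List.Membership.Propositional.Properties using (∈-filter⁺; ∈-filter⁻; ∈-allFin)
  open import Data.List.Relation.Unary.All as All using (All; []; _∷_)
  import Data.List.Relation.Unary.Unique.Propositional.Properties as Unique
  open import Data.Product using (∃; proj₁; proj₂)
  open import Data.Sum using (_⊎_; inj₁; inj₂)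
  open import Data.Empty using (⊥; ⊥-elim)
  open import Function using (_∘_)
  open import Function.Bundles using (Equivalence)
  open import Relation.Binary.PropositionalEquality
  open import Relation.Nullary using (yes; no; does; ¬_; _×-dec_; ¬?)
  open import Relation.Nullary.Decidable using (dec-true; dec-false; T?)
  open FiniteSums
  open DivisorSums
  open Sublists

  X : ℕ
  X = x j

  instance
    X-nonZero : ℕ.NonZero X
    X-nonZero = ℕ.>-nonZero (pos j)

  greatestType : ∀ {z} → z ∈ ys → IsGreatestTypeDivisor x z X
  greatestType {z} = Equivalence.to (gtd z)

  listed : ∀ {z} → IsGreatestTypeDivisor x z X → z ∈ ys
  listed {z} = Equivalence.from (gtd z)

  StrictlyBetween : ℕ → Fin n → Set
  StrictlyBetween g t = g ∣ x t × x t ∣ X × x t ≢ g × x t ≢ X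

  -- every proper divisor g ∈ S of X divides a greatest-type divisor of X:
  -- climb through S along divisibility; X ∸ g decreases strictly on the way
  climb : ∀ fuel g → X ∸ g ≤ fuel → g ∈S x → g ∣ X → g < X →
          ∃ λ y → IsGreatestTypeDivisor x y X × g ∣ y
  climb zero g X∸g≤0 g∈S g∣X g<X = ⊥-elim (ℕP.<⇒≢ (ℕP.m<n⇒0<n∸m g<X) (sym (ℕP.n≤0⇒n≡0 X∸g≤0)))
  climb (suc fuel) g X∸g≤ g∈S g∣X g<X
    with FinP.any? (λ t → (g ∣? x t) ×-dec (x t ∣? X) ×-dec ¬? (x t ℕP.≟ g) ×-dec ¬? (x t ℕP.≟ X))
  ... | no nothingBetween = g , (g∈S , (j , refl) , g<X , g∣X , maximal) , ∣-refl
    where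
    maximal : (t : Fin n) → g ∣ x t → x t ∣ X → (x t ≡ g) ⊎ (x t ≡ X)
    maximal t g∣xt xt∣X with x t ℕP.≟ g | x t ℕP.≟ X
    ... | yes xt≡g | _ = inj₁ xt≡g
    ... | no _ | yes xt≡X = inj₂ xt≡X
    ... | no xt≢g | no xt≢X = ⊥-elim (nothingBetween (t , g∣xt , xt∣X , xt≢g , xt≢X))
  ... | yes (t , g∣w , w∣X , w≢g , w≢X) with climb fuel (x t) X∸w≤ (t , refl) w∣X w<X
    where
    g<w : g < x t
    g<w = ℕP.≤∧≢⇒< (∣⇒≤ {{ℕ.>-nonZero (pos t)}} g∣w) (w≢g ∘ sym)
    w<X : x t < X
    w<X = ℕP.≤∧≢⇒< (∣⇒≤ w∣X) w≢X
    X∸w≤ : X ∸ x t ≤ fuel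
    X∸w≤ = ℕP.≤-pred (ℕP.<-≤-trans (ℕP.∸-monoʳ-< g<w (ℕP.<⇒≤ w<X)) X∸g≤)
  ... | y , y-gtd , w∣y = y , y-gtd , ∣-trans g∣w w∣y

  underGreatestType : ∀ g → g ∈S x → g ∣ X → g < X → ∃ λ y → IsGreatestTypeDivisor x y X × g ∣ y
  underGreatestType g = climb (X ∸ g) g ℕP.≤-refl

  inA : ℕ → Bool
  inA = cond-α x j

  avoidsBelow : ℕ → Fin n → Bool
  avoidsBelow m t = if does (x t ℕP.<? X) then not (does (m ∣? x t)) else true

  avoidsG : ℕ → Bool
  avoidsG m = allB (λ y → not (does (m ∣? y))) ys

  -- greatest-type divisors of X are elements of S below X
  avoidsBelow⇒avoidsG : ∀ m → allB (avoidsBelow m) (allFin n) ≡ true → avoidsG m ≡ true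
  avoidsBelow⇒avoidsG m avoids = allB-intro _ ys (λ y y∈ys → avoidsY y (greatestType y∈ys))
    where
    avoidsY : ∀ y → IsGreatestTypeDivisor x y X → not (does (m ∣? y)) ≡ true
    avoidsY y ((k , refl) , _ , y<X , _) with allB-elim (avoidsBelow m) (allFin n) avoids k (∈-allFin k)
    ... | avoidsK rewrite dec-true (x k ℕP.<? X) y<X = avoidsK

  -- if m ∣ X and m ∣ x_t < X, then m ∣ gcd(x_t, X) ∈ S, a proper divisor of X,
  -- which divides some greatest-type divisor y; so m ∣ y
  avoidsG⇒avoidsBelow : ∀ m → m ∣ X → avoidsG m ≡ true → allB (avoidsBelow m) (allFin n) ≡ true
  avoidsG⇒avoidsBelow m m∣X avoids = allB-intro (avoidsBelow m) (allFin n) (λ t _ → avoidsT t)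
    where
    avoidsT : ∀ t → avoidsBelow m t ≡ true
    avoidsT t with x t ℕP.<? X
    ... | no xt≮X rewrite dec-false (x t ℕP.<? X) xt≮X = refl
    ... | yes xt<X rewrite dec-true (x t ℕP.<? X) xt<X with m ∣? x t
    ...   | no _ = refl
    ...   | yes m∣xt with underGreatestType (gcd (x t) X) (gc t j) (gcd[m,n]∣n (x t) X)
                            (ℕP.≤-<-trans (∣⇒≤ {{ℕ.>-nonZero (pos t)}} (gcd[m,n]∣m (x t) X)) xt<X)
    ...     | y , y-gtd , g∣y with allB-elim _ ys avoids y (listed y-gtd)
    ...       | m∤y rewrite dec-true (m ∣? y) (∣-trans (gcd-greatest m∣xt m∣X) g∣y) = ⊥-elim (false≢true m∤y)
      where
      false≢true : false ≢ true
      false≢true ()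

  inA-via-G : ∀ m → inA m ≡ does (m ∣? X) ∧ avoidsG m
  inA-via-G m with m ∣? X
  ... | no _ = refl
  ... | yes m∣X = Bool-ext (avoidsBelow⇒avoidsG m) (avoidsG⇒avoidsBelow m m∣X)

  -- gcd(X, T) for a sublist T of ys; it equals gcd(T) when T is nonempty
  gcdX : List ℕ → ℕ
  gcdX T = gcd X (gcdList T)

  gcdX>0 : ∀ T → 0 < gcdX T
  gcdX>0 T = ℕP.n≢0⇒n>0 (λ g≡0 → ℕP.<⇒≢ (pos j) (sym (gcd[m,n]≡0⇒m≡0 g≡0)))

  gcdX≤X : ∀ T → gcdX T ≤ X
  gcdX≤X T = ∣⇒≤ (gcd[m,n]∣m X (gcdList T))

  gcdX∈S : ∀ T → All (_∈S x) T → gcdX T ∈S x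
  gcdX∈S [] [] = j , sym (gcd-identityʳ X)
  gcdX∈S (y ∷ T) ((k , xk≡y) ∷ T⊆S) with gcdX∈S T T⊆S
  ... | k′ , xk′≡ with gc k k′
  ... | k″ , xk″≡ = k″ , trans xk″≡ (trans (cong₂ gcd xk≡y xk′≡) (swapGcd y X (gcdList T)))
    where
    swapGcd : ∀ a b c → gcd a (gcd b c) ≡ gcd b (gcd a c)
    swapGcd a b c = trans (sym (gcd-assoc a b c)) (trans (cong (λ z → gcd z c) (gcd-comm a b)) (gcd-assoc b a c))

  ys⊆S : All (_∈S x) ys
  ys⊆S = All.tabulate (λ y∈ys → proj₁ (greatestType y∈ys))

  ys∣X : All (_∣ X) ys
  ys∣X = All.tabulate (λ y∈ys → proj₁ (proj₂ (proj₂ (proj₂ (greatestType y∈ys)))))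

  gcdX-nonEmpty : ∀ T → T ∈ filterᵇ isNonEmpty (sublists ys) → gcdX T ≡ gcdList T
  gcdX-nonEmpty T T∈ with ∈-filter⁻ (T? ∘ isNonEmpty) {xs = sublists ys} T∈
  ... | T∈sublists , _ with T | sublists-All ys ys∣X T T∈sublists
  ... | y ∷ T′ | y∣X ∷ _ = ∣-antisym (gcd[m,n]∣n X (gcdList (y ∷ T′)))
                                   (gcd-greatest (∣-trans (gcd[m,n]∣m y (gcdList T′)) y∣X) ∣-refl)

  inA-inclusionExclusion : ∀ m →
    𝟙 (inA m) ≡ sumℤ (map (λ T → neg1^ (length T) * 𝟙 (does (m ∣? gcdX T))) (sublists ys))
  inA-inclusionExclusion m = begin
    𝟙 (inA m)
      ≡⟨ cong 𝟙 (inA-via-G m) ⟩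
    𝟙 (does (m ∣? X) ∧ avoidsG m)
      ≡⟨ 𝟙-∧ (does (m ∣? X)) (avoidsG m) ⟩
    𝟙 (does (m ∣? X)) * 𝟙 (avoidsG m)
      ≡⟨ cong (𝟙 (does (m ∣? X)) *_) (inclusionExclusion Q ys) ⟩
    𝟙 (does (m ∣? X)) * sumℤ (map (λ T → neg1^ (length T) * 𝟙 (allB Q T)) (sublists ys))
      ≡⟨ sumℤ-*ˡ (𝟙 (does (m ∣? X))) _ (sublists ys) ⟩
    sumℤ (map (λ T → 𝟙 (does (m ∣? X)) * (neg1^ (length T) * 𝟙 (allB Q T))) (sublists ys))
      ≡⟨ sumℤ-cong _ _ (sublists ys) (λ T _ → term T) ⟩
    sumℤ (map (λ T → neg1^ (length T) * 𝟙 (does (m ∣? gcdX T))) (sublists ys)) ∎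
    where
    open ≡-Reasoning
    Q : ℕ → Bool
    Q y = does (m ∣? y)
    swap : ∀ a b c → a * (b * c) ≡ b * (a * c)
    swap = solve-∀
    ∣?-gcdX : ∀ T → does (m ∣? gcdX T) ≡ does (m ∣? X) ∧ allB Q T
    ∣?-gcdX T = trans (∣?-gcd m X (gcdList T)) (cong (does (m ∣? X) ∧_) (∣?-gcdList m T))
    term : ∀ T → 𝟙 (does (m ∣? X)) * (neg1^ (length T) * 𝟙 (allB Q T))
               ≡ neg1^ (length T) * 𝟙 (does (m ∣? gcdX T))
    term T = trans (swap (𝟙 (does (m ∣? X))) (neg1^ (length T)) (𝟙 (allB Q T)))
                   (cong (neg1^ (length T) *_) (sym (trans (cong 𝟙 (∣?-gcdX T)) (𝟙-∧ (does (m ∣? X)) (allB Q T)))))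

  c′ : ℕ → ℤ
  c′ d = ∑ X (λ e → 𝟙 (inA (e ℕ.* d)) * μ e)

  c≡c′ : ∀ i → c x i j ≡ c′ (x i)
  c≡c′ i = trans (sumℤ-filterᵇ (cond-c x i j) μ (oneTo X)) (sumℤ-oneTo X _)

  c′-expansion : ∀ d → 0 < d →
    c′ d ≡ sumℤ (map (λ T → neg1^ (length T) * sumDivμFrac (gcdX T) d) (sublists ys))
  c′-expansion d d>0 = begin
    ∑ X (λ e → 𝟙 (inA (e ℕ.* d)) * μ e)
      ≡⟨ ∑-cong X (λ e _ _ → expand e) ⟩
    ∑ X (λ e → sumℤ (map (λ T → neg1^ (length T) * (𝟙 (does (e ℕ.* d ∣? gcdX T)) * μ e)) S))
      ≡⟨ sym (sumℤ-∑-swap X _ S) ⟩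
    sumℤ (map (λ T → ∑ X (λ e → neg1^ (length T) * (𝟙 (does (e ℕ.* d ∣? gcdX T)) * μ e))) S)
      ≡⟨ sumℤ-cong _ _ S (λ T _ → trans (sym (∑-*ˡ X (neg1^ (length T)) _))
                                        (cong (neg1^ (length T) *_) (sumDivμFrac-∑ (gcdX T) d X (gcdX>0 T) d>0 (gcdX≤X T)))) ⟩
    sumℤ (map (λ T → neg1^ (length T) * sumDivμFrac (gcdX T) d) S) ∎
    where
    open ≡-Reasoning
    S = sublists ys
    reassoc : ∀ a b c → (a * b) * c ≡ a * (b * c)
    reassoc = solve-∀
    expand : ∀ e → 𝟙 (inA (e ℕ.* d)) * μ e
                 ≡ sumℤ (map (λ T → neg1^ (length T) * (𝟙 (does (e ℕ.* d ∣? gcdX T)) * μ e)) S)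
    expand e = begin
      𝟙 (inA (e ℕ.* d)) * μ e
        ≡⟨ trans (cong (_* μ e) (inA-inclusionExclusion (e ℕ.* d))) (ℤP.*-comm _ (μ e)) ⟩
      μ e * sumℤ (map (λ T → neg1^ (length T) * 𝟙 (does (e ℕ.* d ∣? gcdX T))) S)
        ≡⟨ sumℤ-*ˡ (μ e) _ S ⟩
      sumℤ (map (λ T → μ e * (neg1^ (length T) * 𝟙 (does (e ℕ.* d ∣? gcdX T)))) S)
        ≡⟨ sumℤ-cong _ _ S (λ T _ → trans (ℤP.*-comm (μ e) _) (reassoc (neg1^ (length T)) _ (μ e))) ⟩
      sumℤ (map (λ T → neg1^ (length T) * (𝟙 (does (e ℕ.* d ∣? gcdX T)) * μ e)) S) ∎

  -- the first formula: split off the empty sublist, for which gcd(X, []) = X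
  firstFormula : ∀ i → c x i j ≡ sumDivμFrac X (x i)
    + sumℤ (map (λ T → neg1^ (length T) * sumDivμFrac (gcdList T) (x i)) (filterᵇ isNonEmpty (sublists ys)))
  firstFormula i = begin
    c x i j
      ≡⟨ trans (c≡c′ i) (c′-expansion (x i) (pos i)) ⟩
    sumℤ (map h (sublists ys))
      ≡⟨ sumℤ-sublists h ys ⟩
    h [] + sumℤ (map h (filterᵇ isNonEmpty (sublists ys)))
      ≡⟨ cong₂ _+_ (trans (ℤP.*-identityˡ _) (cong (λ z → sumDivμFrac z (x i)) (gcd-identityʳ X)))
                   (sumℤ-cong _ _ (filterᵇ isNonEmpty (sublists ys))
                      (λ T T∈ → cong (λ z → neg1^ (length T) * sumDivμFrac z (x i)) (gcdX-nonEmpty T T∈))) ⟩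
    sumDivμFrac X (x i)
      + sumℤ (map (λ T → neg1^ (length T) * sumDivμFrac (gcdList T) (x i)) (filterᵇ isNonEmpty (sublists ys))) ∎
    where
    open ≡-Reasoning
    h : List ℕ → ℤ
    h T = neg1^ (length T) * sumDivμFrac (gcdX T) (x i)

  -- c′ d vanishes unless d ∈ S: by c′-expansion every term has
  -- Σ_{e ∣ gcd(X, T)/d} μ(e) = [gcd(X, T) = d] and gcd(X, T) ∈ S
  c′-outsideS : ∀ d → 0 < d → ¬ (d ∈S x) → c′ d ≡ + 0
  c′-outsideS d d>0 d∉S = trans (c′-expansion d d>0) (sumℤ-zero (sublists ys) vanish)
    where
    vanish : ∀ T → T ∈ sublists ys → neg1^ (length T) * sumDivμFrac (gcdX T) d ≡ + 0
    vanish T T∈ = trans (cong (neg1^ (length T) *_) (sumDivμFrac-≢ (gcdX T) d (gcdX>0 T) gcd≢d))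
                        (ℤP.*-zeroʳ (neg1^ (length T)))
      where
      gcd≢d : gcdX T ≢ d
      gcd≢d gcd≡d with gcdX∈S T (sublists-All ys ys⊆S T T∈)
      ... | k , xk≡gcd = d∉S (k , trans xk≡gcd gcd≡d)

  -- elements of A divide X, so c′ d vanishes unless d ∣ X
  c′-nonDivisor : ∀ d → ¬ (d ∣ X) → c′ d ≡ + 0
  c′-nonDivisor d d∤X = ∑-zero X vanish
    where
    vanish : ∀ e → 1 ≤ e → e ≤ X → 𝟙 (inA (e ℕ.* d)) * μ e ≡ + 0
    vanish e _ _ rewrite inA-via-G (e ℕ.* d) | dec-false (e ℕ.* d ∣? X) (λ ed∣X → d∤X (∣-trans (n∣m*n e) ed∣X)) = refl

  inA⇒∣X : ∀ m → inA m ≡ true → m ∣ X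
  inA⇒∣X m m∈A with m ∣? X | inA-via-G m
  ... | yes m∣X | _ = m∣X
  ... | no _ | m∉A rewrite m∉A with m∈A
  ...   | ()

  divisorsInS : List (Fin n)
  divisorsInS = filter (λ k → x k ∣? X) (allFin n)

  -- so d·c′ d survives only at the values d = x_k ∣ X, each taken once
  c′-supported : Injective _≡_ _≡_ x → ∀ d → 0 < d →
                 + d * c′ d ≡ countValue divisorsInS x d * (+ d * c′ d)
  c′-supported inj d d>0 with d ∣? X
  ... | no d∤X rewrite c′-nonDivisor d d∤X | ℤP.*-zeroʳ (+ d) = sym (ℤP.*-zeroʳ (countValue divisorsInS x d))
  ... | yes d∣X with FinP.any? (λ k → x k ℕP.≟ d)
  ...   | no d∉S rewrite c′-outsideS d d>0 d∉S | ℤP.*-zeroʳ (+ d) = sym (ℤP.*-zeroʳ (countValue divisorsInS x d))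
  ...   | yes (k , refl)
    rewrite countValue-unique x inj divisorsInS k
              (Unique.filter⁺ (λ k → x k ∣? X) (Unique.allFin⁺ n))
              (∈-filter⁺ (λ k → x k ∣? X) (∈-allFin k) d∣X) = sym (ℤP.*-identityˡ _)

  secondFormula : Injective _≡_ _≡_ x → + α x j ≡ sumℤ (map (λ k → + x k * c x k j) divisorsInS)
  secondFormula inj = begin
    + α x j
      ≡⟨ sumℕ-ℤ φ (filterᵇ inA (oneTo X)) ⟩
    sumℤ (map (λ m → + φ m) (filterᵇ inA (oneTo X)))
      ≡⟨ trans (sumℤ-filterᵇ inA (λ m → + φ m) (oneTo X)) (sumℤ-oneTo X _) ⟩
    ∑ X (λ m → 𝟙 (inA m) * + φ m)
      ≡⟨ ∑-φ X inA (λ m m∈A → ∣⇒≤ (inA⇒∣X m m∈A)) ⟩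
    ∑ X (λ d → + d * c′ d)
      ≡⟨ ∑-cong X (λ d d≥1 _ → c′-supported inj d d≥1) ⟩
    ∑ X (λ d → countValue divisorsInS x d * (+ d * c′ d))
      ≡⟨ sym (sumℤ-byValue X x (λ d → + d * c′ d) divisorsInS inRange) ⟩
    sumℤ (map (λ k → + x k * c′ (x k)) divisorsInS)
      ≡⟨ sumℤ-cong _ _ divisorsInS (λ k _ → cong (+ x k *_) (sym (c≡c′ k))) ⟩
    sumℤ (map (λ k → + x k * c x k j) divisorsInS) ∎
    where
    open ≡-Reasoning
    inRange : All (λ k → 1 ≤ x k × x k ≤ X) divisorsInS
    inRange = All.tabulate (λ {k} k∈ → pos k , ∣⇒≤ (proj₂ (∈-filter⁻ (λ k → x k ∣? X) {xs = allFin n} k∈)))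

lemma2p3 : (n : ℕ) (x : Fin n → ℕ) →
           (∀ k → 0 < x k) → Injective _≡_ _≡_ x → GcdClosed x →
           (i j : Fin n) (ys : List ℕ) → Unique ys →
           (∀ z → (z ∈ ys) ⇔ IsGreatestTypeDivisor x z (x j)) →
           (c x i j ≡ sumDivμFrac (x j) (x i)
                      + sumℤ (map (λ T → neg1^ (length T) * sumDivμFrac (gcdList T) (x i))
                                  (filterᵇ isNonEmpty (sublists ys))))
           × (+ α x j ≡ sumℤ (map (λ k → + x k * c x k j)
                                  (filter (λ k → x k ∣? x j) (allFin n))))
lemma2p3 n x pos inj gcdClosed i j ys _ gtd = firstFormula i , secondFormula inj
  where open GcdClosedSet n x pos gcdClosed j ys gtd
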